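{- For any nonempty team $X$ on a set $\{p_1,\dots,p_n\}$ of propositional variables, the $\mathbf{PD}$-formula $\Theta_X=\bigotimes_{v\in X}(p_1^{v(p_1)}\wedge\dots\wedge p_n^{v(p_n)})$ is $\mathcal{F}$-projective in $\mathbf{PD}$, where $\mathcal{F}$ is the class of all flat substitutions.
   Context: A valuation is a function $v:\mathrm{Prop}\to\{0,1\}$; a team is a set of valuations; a team on $V$ is a set of functions $V\to\{0,1\}$. $p^1:=p$, $p^0:=\neg p$. Formulas of $\mathbf{PD}$: $\phi::=p\mid\bot\mid\top\mid{=}(\alpha_1,\dots,\alpha_k,\beta)\mid\neg\phi\mid\phi\wedge\phi\mid\phi\otimes\phi$ with $\alpha_i,\beta$ flat $\mathbf{PD}$-formulas. Team semantics: $X\models p$ iff $v(p)=1$ for all $v\in X$; $X\models\bot$ iff $X=\emptyset$; $X\models\top$ always; $X\models\neg\phi$ iff $\{v\}\not\models\phi$ for all $v\in X$; $X\models\phi\wedge\psi$ iff both; $X\models\phi\otimes\psi$ iff $X=Y\cup Z$ for some $Y,Z\subseteq X$ with $Y\models\phi$, $Z\models\psi$; $X\models{=}(\vec\alpha,\beta)$ iff for all $v,v'\in X$, if $\{v\}\models\alpha_i\Leftrightarrow\{v'\}\models\alpha_i$ for all $i$ then $\{v\}\models\beta\Leftrightarrow\{v'\}\models\beta$. A formula is flat if $X\models\phi$ iff $\{v\}\models\phi$ for all $v\in X$, for every team $X$. $\Gamma\vdash_{\mathbf{PD}}\phi$ iff all formulas are $\mathbf{PD}$-formulas and every team satisfying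 all of $\Gamma$ satisfies $\phi$. A substitution is a map on $\mathbf{PD}$-formulas commuting with all connectives and atoms; flat if each $\sigma(p)$ is flat. For a set $\mathcal{S}$ of substitutions, $\phi$ is $\mathcal{S}$-projective in $\mathbf{PD}$ if there is $\sigma\in\mathcal{S}$ with $\vdash_{\mathbf{PD}}\sigma(\phi)$ and, for every variable $p$, $\phi,\sigma(p)\vdash_{\mathbf{PD}}p$ and $\phi,p\vdash_{\mathbf{PD}}\sigma(p)$. -}

module Defs where

open import Level using (Level; Lift; lift; 0ℓ) renaming (suc to lsuc)
open import Data.Nat using (ℕ)
open import Data.Bool using (Bool; true; false)
open import Data.Fin using (Fin; zero; suc)
open import Data.List using (List; []; _∷_)
open import Data.List.NonEmpty using (List⁺; _∷_)
open import Data.List.Relation.Unary.All using (All)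
open import Data.Product using (Σ; _×_; _,_)
open import Data.Sum using (_⊎_)
open import Data.Empty using (⊥)
open import Relation.Nullary using (¬_)
open import Relation.Binary.PropositionalEquality using (_≡_)

-- Syntax.  Propositional variables are natural numbers.
-- `dep αs β` is the dependence atom =(α₁,…,αₖ,β); the requirement that
-- the αᵢ and β be flat is imposed by the predicate `IsPD` below.

data Formula : Set where
  var  : ℕ → Formula
  bot  : Formula
  top  : Formula
  dep  : List Formula → Formula → Formula
  neg  : Formula → Formula
  _∧ᶠ_ : Formula → Formula → Formula
  _⊗_  : Formula → Formula → Formula

infixr 6 _∧ᶠ_
infixr 5 _⊗_

-- Valuations and teams (arbitrary sets of valuations, as predicates).

Valuation : Set
Valuation = ℕ → Bool

Team : Set₁
Team = Valuation → Set

single : Valuation → Team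
single v u = ∀ p → u p ≡ v p

_⊆ₜ_ : Team → Team → Set
X ⊆ₜ Y = ∀ v → X v → Y v

_∪ₜ_ : Team → Team → Team
(X ∪ₜ Y) v = X v ⊎ Y v

_⇔₁_ : Set₁ → Set₁ → Set₁
A ⇔₁ B = (A → B) × (B → A)

mutual
  Sat : Formula → Team → Set₁
  Sat (var p)   X = Lift (lsuc 0ℓ) (∀ v → X v → v p ≡ true)
  Sat bot       X = Lift (lsuc 0ℓ) (∀ v → ¬ X v)
  Sat top       X = Lift (lsuc 0ℓ) (Data.Unit.⊤)
    where import Data.Unit
  Sat (dep αs β) X =
    ∀ v v' → X v → X v' → AgreeAll αs v v' → (Sat β (single v) ⇔₁ Sat β (single v'))
  Sat (neg φ)   X = ∀ v → X v → ¬ Sat φ (single v)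
  Sat (φ ∧ᶠ ψ)  X = Sat φ X × Sat ψ X
  Sat (φ ⊗ ψ)   X = Σ Team λ Y → Σ Team λ Z →
    (Y ⊆ₜ X) × (Z ⊆ₜ X) × (X ⊆ₜ (Y ∪ₜ Z)) × Sat φ Y × Sat ψ Z

  AgreeAll : List Formula → Valuation → Valuation → Set₁
  AgreeAll []       v v' = Lift (lsuc 0ℓ) (Data.Unit.⊤)
    where import Data.Unit
  AgreeAll (α ∷ αs) v v' = (Sat α (single v) ⇔₁ Sat α (single v')) × AgreeAll αs v v'

Flat : Formula → Set₁
Flat φ = ∀ (X : Team) → Sat φ X ⇔₁ (∀ v → X v → Sat φ (single v))

mutual
  IsPD : Formula → Set₁
  IsPD (var p)    = Lift (lsuc 0ℓ) (Data.Unit.⊤)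
    where import Data.Unit
  IsPD bot        = Lift (lsuc 0ℓ) (Data.Unit.⊤)
    where import Data.Unit
  IsPD top        = Lift (lsuc 0ℓ) (Data.Unit.⊤)
    where import Data.Unit
  IsPD (dep αs β) = FlatPDAll αs × (IsPD β × Flat β)
  IsPD (neg φ)    = IsPD φ
  IsPD (φ ∧ᶠ ψ)   = IsPD φ × IsPD ψ
  IsPD (φ ⊗ ψ)    = IsPD φ × IsPD ψ

  FlatPDAll : List Formula → Set₁
  FlatPDAll []       = Lift (lsuc 0ℓ) (Data.Unit.⊤)
    where import Data.Unit
  FlatPDAll (α ∷ αs) = (IsPD α × Flat α) × FlatPDAll αs

_⊢PD_ : List Formula → Formula → Set₁
Γ ⊢PD φ = All IsPD Γ × IsPD φ × (∀ (X : Team) → All (λ γ → Sat γ X) Γ → Sat φ X)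

Subst : Set
Subst = ℕ → Formula

mutual
  applySubst : Subst → Formula → Formula
  applySubst σ (var p)    = σ p
  applySubst σ bot        = bot
  applySubst σ top        = top
  applySubst σ (dep αs β) = dep (applyAll σ αs) (applySubst σ β)
  applySubst σ (neg φ)    = neg (applySubst σ φ)
  applySubst σ (φ ∧ᶠ ψ)   = applySubst σ φ ∧ᶠ applySubst σ ψ
  applySubst σ (φ ⊗ ψ)    = applySubst σ φ ⊗ applySubst σ ψ

  applyAll : Subst → List Formula → List Formula
  applyAll σ []       = []
  applyAll σ (α ∷ αs) = applySubst σ α ∷ applyAll σ αs

-- a substitution (a map on PD-formulas, so each σ(p) is a PD-formula)
-- is flat if every σ(p) is flat
FlatSubst : Subst → Set₁
FlatSubst σ = ∀ p → IsPD (σ p) × Flat (σ p)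

Projective : (Subst → Set₁) → Formula → Set₁
Projective S φ = Σ Subst λ σ → S σ ×
  ([] ⊢PD applySubst σ φ) ×
  (∀ p → ((φ ∷ σ p ∷ []) ⊢PD var p) × ((φ ∷ var p ∷ []) ⊢PD σ p))

-- p^1 = p, p^0 = ¬p
lit : ℕ → Bool → Formula
lit p true  = var p
lit p false = neg (var p)

bigAnd : List Formula → Formula
bigAnd []           = top
bigAnd (φ ∷ [])     = φ
bigAnd (φ ∷ ψ ∷ ψs) = φ ∧ᶠ bigAnd (ψ ∷ ψs)

tensorList : Formula → List Formula → Formula
tensorList φ []       = φ
tensorList φ (ψ ∷ ψs) = φ ⊗ tensorList ψ ψs

bigTensor : List⁺ Formula → Formula
bigTensor (φ ∷ ψs) = tensorList φ ψs

-- the variables p₁,…,pₙ are given by names : Fin n → ℕ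
conjOf : ∀ {n} → (Fin n → ℕ) → (Fin n → Bool) → Formula
conjOf {n} names s = bigAnd (Data.List.tabulate (λ i → lit (names i) (s i)))
  where import Data.List

-- Θ_X for a nonempty team X on {p₁,…,pₙ}, given as a nonempty list
-- enumerating its elements (functions {p₁,…,pₙ} → {0,1})
Theta : ∀ {n} → (Fin n → ℕ) → List⁺ (Fin n → Bool) → Formula
Theta names X = bigTensor (Data.List.NonEmpty.map (conjOf names) X)
  where import Data.List.NonEmpty

module Submission where

-- Θ_X contains no dependence atoms, so it is a classical formula: in team
-- semantics such a formula is flat and holds in a team iff it evaluates to
-- true (reading ⊗ as ∨) at every member.  Every classical formula φ with a
-- model u is then projective via Ghilardi's substitution
--   σ(p) = (φ ∧ p) ⊗ (¬φ ∧ [u(p)]),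
-- which fixes every model of φ and sends every other valuation to u.  So
-- σ(φ) is valid, while under φ each σ(p) is equivalent to p.  For Θ_X a model
-- is any valuation extending an element of X, which exists since the names
-- p₁,…,pₙ are distinct.

open import Defs
open import Data.Nat using (ℕ; zero; suc; _≟_)
open import Data.Bool using (Bool; true; false; not; _∧_; _∨_; T; if_then_else_)
open import Data.Bool.Properties using (T-≡; T-∧; T-∨; ∨-identityʳ)
open import Data.Fin using (Fin; zero; suc)
open import Data.Fin.Properties using (suc-injective)
open import Data.List using ([]; _∷_; map)
open import Data.List.NonEmpty using (List⁺; _∷_)
open import Data.List.Relation.Unary.All as All using (All; []; _∷_)
open import Data.List.Relation.Unary.All.Properties using (tabulate⁺; map⁺)
open import Data.Product using (_×_; _,_; proj₁; proj₂)
open import Data.Sum as Sum using (inj₁; inj₂)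
open import Data.Empty using (⊥; ⊥-elim)
open import Data.Unit using (⊤; tt)
open import Function using (_∘_)
open import Function.Bundles using (Equivalence)
open import Function.Definitions using (Injective)
open import Level using (lift)
open import Relation.Nullary using (yes; no)
open import Relation.Binary.PropositionalEquality
  using (_≡_; refl; sym; trans; cong; cong₂; subst)

open Equivalence using (to; from)

Classical : Formula → Set
Classical (var p)   = ⊤
Classical bot       = ⊤
Classical top       = ⊤
Classical (dep _ _) = ⊥
Classical (neg φ)   = Classical φ
Classical (φ ∧ᶠ ψ)  = Classical φ × Classical ψ
Classical (φ ⊗ ψ)   = Classical φ × Classical ψ

⟦_⟧ : Formula → Valuation → Bool
⟦ var p ⟧   v = v p
⟦ bot ⟧     v = false
⟦ top ⟧     v = true
⟦ dep _ _ ⟧ v = false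
⟦ neg φ ⟧   v = not (⟦ φ ⟧ v)
⟦ φ ∧ᶠ ψ ⟧  v = ⟦ φ ⟧ v ∧ ⟦ ψ ⟧ v
⟦ φ ⊗ ψ ⟧   v = ⟦ φ ⟧ v ∨ ⟦ ψ ⟧ v

⟦⟧-cong : ∀ φ {u v} → (∀ p → u p ≡ v p) → ⟦ φ ⟧ u ≡ ⟦ φ ⟧ v
⟦⟧-cong (var p)   u≗v = u≗v p
⟦⟧-cong bot       u≗v = refl
⟦⟧-cong top       u≗v = refl
⟦⟧-cong (dep _ _) u≗v = refl
⟦⟧-cong (neg φ)   u≗v = cong not (⟦⟧-cong φ u≗v)
⟦⟧-cong (φ ∧ᶠ ψ)  u≗v = cong₂ _∧_ (⟦⟧-cong φ u≗v) (⟦⟧-cong ψ u≗v)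
⟦⟧-cong (φ ⊗ ψ)   u≗v = cong₂ _∨_ (⟦⟧-cong φ u≗v) (⟦⟧-cong ψ u≗v)

single-refl : ∀ v → single v v
single-refl v p = refl

mutual
  sat⇒T : ∀ φ → Classical φ → ∀ X → Sat φ X → ∀ v → X v → T (⟦ φ ⟧ v)
  sat⇒T (var p)  _ X (lift X⊨p) v v∈X = from T-≡ (X⊨p v v∈X)
  sat⇒T bot      _ X (lift X=∅) v v∈X = ⊥-elim (X=∅ v v∈X)
  sat⇒T top      _ X _          v v∈X = tt
  sat⇒T (neg φ)  c X X⊨¬φ v v∈X with ⟦ φ ⟧ v in eq
  ... | true  = X⊨¬φ v v∈X (T⇒sat-single φ c v (subst T (sym eq) tt))
  ... | false = tt
  sat⇒T (φ ∧ᶠ ψ) (c , d) X (X⊨φ , X⊨ψ) v v∈X =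
    from T-∧ (sat⇒T φ c X X⊨φ v v∈X , sat⇒T ψ d X X⊨ψ v v∈X)
  sat⇒T (φ ⊗ ψ)  (c , d) X (Y , Z , _ , _ , X⊆Y∪Z , Y⊨φ , Z⊨ψ) v v∈X
    with X⊆Y∪Z v v∈X
  ... | inj₁ v∈Y = from T-∨ (inj₁ (sat⇒T φ c Y Y⊨φ v v∈Y))
  ... | inj₂ v∈Z = from T-∨ (inj₂ (sat⇒T ψ d Z Z⊨ψ v v∈Z))

  T⇒sat : ∀ φ → Classical φ → ∀ X → (∀ v → X v → T (⟦ φ ⟧ v)) → Sat φ X
  T⇒sat (var p)  _ X φ∈X = lift λ v v∈X → to T-≡ (φ∈X v v∈X)
  T⇒sat bot      _ X φ∈X = lift λ v v∈X → φ∈X v v∈X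
  T⇒sat top      _ X φ∈X = lift tt
  T⇒sat (neg φ)  c X ¬φ∈X v v∈X single⊨φ =
    not-both (⟦ φ ⟧ v) (¬φ∈X v v∈X) (sat⇒T φ c (single v) single⊨φ v (single-refl v))
    where not-both : ∀ b → T (not b) → T b → ⊥
          not-both false _ ()
          not-both true  ()
  T⇒sat (φ ∧ᶠ ψ) (c , d) X φψ∈X =
    T⇒sat φ c X (λ v → proj₁ ∘ to T-∧ ∘ φψ∈X v) ,
    T⇒sat ψ d X (λ v → proj₂ ∘ to T-∧ ∘ φψ∈X v)
  T⇒sat (φ ⊗ ψ)  (c , d) X φψ∈X =
    (λ v → X v × T (⟦ φ ⟧ v)) , (λ v → X v × T (⟦ ψ ⟧ v)) ,
    (λ _ → proj₁) , (λ _ → proj₁) ,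
    (λ v v∈X → Sum.map (v∈X ,_) (v∈X ,_) (to T-∨ (φψ∈X v v∈X))) ,
    T⇒sat φ c _ (λ _ → proj₂) , T⇒sat ψ d _ (λ _ → proj₂)

  T⇒sat-single : ∀ φ → Classical φ → ∀ v → T (⟦ φ ⟧ v) → Sat φ (single v)
  T⇒sat-single φ c v φv = T⇒sat φ c (single v) λ u u≗v → subst T (sym (⟦⟧-cong φ u≗v)) φv

classical⇒flat : ∀ φ → Classical φ → Flat φ
classical⇒flat φ c X =
  (λ X⊨φ v v∈X → T⇒sat-single φ c v (sat⇒T φ c X X⊨φ v v∈X)) ,
  (λ pointwise → T⇒sat φ c X λ v v∈X → sat⇒T φ c (single v) (pointwise v v∈X) v (single-refl v))

classical⇒isPD : ∀ φ → Classical φ → IsPD φ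
classical⇒isPD (var p)  _       = lift tt
classical⇒isPD bot      _       = lift tt
classical⇒isPD top      _       = lift tt
classical⇒isPD (neg φ)  c       = classical⇒isPD φ c
classical⇒isPD (φ ∧ᶠ ψ) (c , d) = classical⇒isPD φ c , classical⇒isPD ψ d
classical⇒isPD (φ ⊗ ψ)  (c , d) = classical⇒isPD φ c , classical⇒isPD ψ d

⊢PD-fromValuations : ∀ Γ φ → All Classical Γ → Classical φ →
  (∀ v → All (λ γ → T (⟦ γ ⟧ v)) Γ → T (⟦ φ ⟧ v)) → Γ ⊢PD φ
⊢PD-fromValuations Γ φ cΓ cφ Γ⊨φ =
  All.map (λ {γ} → classical⇒isPD γ) cΓ , classical⇒isPD φ cφ ,
  λ X X⊨Γ → T⇒sat φ cφ X λ v v∈X →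
    Γ⊨φ v (All.zipWith (λ {γ} (cγ , X⊨γ) → sat⇒T γ cγ X X⊨γ v v∈X) (cΓ , X⊨Γ))

classical-applySubst : ∀ σ φ → (∀ p → Classical (σ p)) → Classical φ →
  Classical (applySubst σ φ)
classical-applySubst σ (var p)  cσ _       = cσ p
classical-applySubst σ bot      cσ _       = tt
classical-applySubst σ top      cσ _       = tt
classical-applySubst σ (neg φ)  cσ c       = classical-applySubst σ φ cσ c
classical-applySubst σ (φ ∧ᶠ ψ) cσ (c , d) =
  classical-applySubst σ φ cσ c , classical-applySubst σ ψ cσ d
classical-applySubst σ (φ ⊗ ψ)  cσ (c , d) =
  classical-applySubst σ φ cσ c , classical-applySubst σ ψ cσ d

⟦applySubst⟧ : ∀ σ φ v → ⟦ applySubst σ φ ⟧ v ≡ ⟦ φ ⟧ (λ q → ⟦ σ q ⟧ v)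
⟦applySubst⟧ σ (var p)   v = refl
⟦applySubst⟧ σ bot       v = refl
⟦applySubst⟧ σ top       v = refl
⟦applySubst⟧ σ (dep _ _) v = refl
⟦applySubst⟧ σ (neg φ)   v = cong not (⟦applySubst⟧ σ φ v)
⟦applySubst⟧ σ (φ ∧ᶠ ψ)  v = cong₂ _∧_ (⟦applySubst⟧ σ φ v) (⟦applySubst⟧ σ ψ v)
⟦applySubst⟧ σ (φ ⊗ ψ)   v = cong₂ _∨_ (⟦applySubst⟧ σ φ v) (⟦applySubst⟧ σ ψ v)

constant : Bool → Formula
constant true  = top
constant false = bot

classical-constant : ∀ b → Classical (constant b)
classical-constant true  = tt
classical-constant false = tt

⟦constant⟧ : ∀ b v → ⟦ constant b ⟧ v ≡ b
⟦constant⟧ true  v = refl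
⟦constant⟧ false v = refl

ghilardi : Formula → Valuation → Subst
ghilardi φ u p = (φ ∧ᶠ var p) ⊗ (neg φ ∧ᶠ constant (u p))

classical-ghilardi : ∀ φ u → Classical φ → ∀ p → Classical (ghilardi φ u p)
classical-ghilardi φ u c p = (c , tt) , (c , classical-constant (u p))

⟦ghilardi⟧ : ∀ φ u v p → ⟦ ghilardi φ u p ⟧ v ≡ (if ⟦ φ ⟧ v then v else u) p
⟦ghilardi⟧ φ u v p with ⟦ φ ⟧ v
... | true  = ∨-identityʳ (v p)
... | false = ⟦constant⟧ (u p) v

ghilardi-fixes-models : ∀ φ u v p → T (⟦ φ ⟧ v) → ⟦ ghilardi φ u p ⟧ v ≡ v p
ghilardi-fixes-models φ u v p φv with ⟦ φ ⟧ v
... | true = ∨-identityʳ (v p)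

ghilardi-valid : ∀ φ u → T (⟦ φ ⟧ u) → ∀ v → T (⟦ applySubst (ghilardi φ u) φ ⟧ v)
ghilardi-valid φ u φu v =
  subst T (sym (trans (⟦applySubst⟧ σ φ v) (⟦⟧-cong φ (⟦ghilardi⟧ φ u v)))) (model (⟦ φ ⟧ v) refl)
  where
  σ : Subst
  σ = ghilardi φ u
  model : ∀ b → ⟦ φ ⟧ v ≡ b → T (⟦ φ ⟧ (if b then v else u))
  model true  φv = subst T (sym φv) tt
  model false _  = φu

classical-projective : ∀ φ → Classical φ → (u : Valuation) → T (⟦ φ ⟧ u) →
  Projective FlatSubst φ
classical-projective φ c u φu =
  σ ,
  (λ p → classical⇒isPD (σ p) (cσ p) , classical⇒flat (σ p) (cσ p)) ,
  ⊢PD-fromValuations [] (applySubst σ φ) [] (classical-applySubst σ φ cσ c)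
    (λ v _ → ghilardi-valid φ u φu v) ,
  λ p →
    ⊢PD-fromValuations (φ ∷ σ p ∷ []) (var p) (c ∷ cσ p ∷ []) tt
      (λ { v (φv ∷ σpv ∷ []) → subst T (ghilardi-fixes-models φ u v p φv) σpv }) ,
    ⊢PD-fromValuations (φ ∷ var p ∷ []) (σ p) (c ∷ tt ∷ []) (cσ p)
      (λ { v (φv ∷ pv ∷ []) → subst T (sym (ghilardi-fixes-models φ u v p φv)) pv })
  where
  σ : Subst
  σ = ghilardi φ u
  cσ : ∀ p → Classical (σ p)
  cσ = classical-ghilardi φ u c

classical-bigAnd : ∀ φs → All Classical φs → Classical (bigAnd φs)
classical-bigAnd []           _        = tt
classical-bigAnd (φ ∷ [])     (c ∷ []) = c
classical-bigAnd (φ ∷ ψ ∷ ψs) (c ∷ cs) = c , classical-bigAnd (ψ ∷ ψs) cs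

T-bigAnd : ∀ φs v → All (λ φ → T (⟦ φ ⟧ v)) φs → T (⟦ bigAnd φs ⟧ v)
T-bigAnd []           v _          = tt
T-bigAnd (φ ∷ [])     v (φv ∷ [])  = φv
T-bigAnd (φ ∷ ψ ∷ ψs) v (φv ∷ ψsv) = from T-∧ (φv , T-bigAnd (ψ ∷ ψs) v ψsv)

classical-tensorList : ∀ φ ψs → Classical φ → All Classical ψs → Classical (tensorList φ ψs)
classical-tensorList φ []       c _        = c
classical-tensorList φ (ψ ∷ ψs) c (d ∷ ds) = c , classical-tensorList ψ ψs d ds

T-tensorList-head : ∀ φ ψs v → T (⟦ φ ⟧ v) → T (⟦ tensorList φ ψs ⟧ v)
T-tensorList-head φ []       v φv = φv
T-tensorList-head φ (ψ ∷ ψs) v φv = from T-∨ (inj₁ φv)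

classical-lit : ∀ p b → Classical (lit p b)
classical-lit p true  = tt
classical-lit p false = tt

T-lit : ∀ p b v → v p ≡ b → T (⟦ lit p b ⟧ v)
T-lit p true  v vp≡b = subst T (sym vp≡b) tt
T-lit p false v vp≡b = subst (T ∘ not) (sym vp≡b) tt

classical-conjOf : ∀ {n} (names : Fin n → ℕ) s → Classical (conjOf names s)
classical-conjOf names s = classical-bigAnd _ (tabulate⁺ λ i → classical-lit (names i) (s i))

T-conjOf : ∀ {n} (names : Fin n → ℕ) s v → (∀ i → v (names i) ≡ s i) → T (⟦ conjOf names s ⟧ v)
T-conjOf names s v v∘names≡s = T-bigAnd _ v (tabulate⁺ λ i → T-lit (names i) (s i) v (v∘names≡s i))

classical-Theta : ∀ {n} (names : Fin n → ℕ) X → Classical (Theta names X)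
classical-Theta names (s ∷ ss) =
  classical-tensorList _ _ (classical-conjOf names s) (map⁺ (All.universal (classical-conjOf names) ss))

-- Outside the range of names the value is arbitrary (false).
extend : ∀ {n} → (Fin n → ℕ) → (Fin n → Bool) → Valuation
extend {zero}  names s p = false
extend {suc n} names s p with names zero ≟ p
... | yes _ = s zero
... | no  _ = extend (names ∘ suc) (s ∘ suc) p

extend-names : ∀ {n} (names : Fin n → ℕ) → Injective _≡_ _≡_ names →
  ∀ s i → extend names s (names i) ≡ s i
extend-names {suc n} names inj s i with names zero ≟ names i
extend-names {suc n} names inj s zero    | yes _  = refl
extend-names {suc n} names inj s (suc i) | yes eq with () ← inj eq
extend-names {suc n} names inj s zero    | no ne  = ⊥-elim (ne refl)
extend-names {suc n} names inj s (suc i) | no _   =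
  extend-names (names ∘ suc) (suc-injective ∘ inj) (s ∘ suc) i

T-Theta-extend : ∀ {n} (names : Fin n → ℕ) → Injective _≡_ _≡_ names →
  ∀ s ss → T (⟦ Theta names (s ∷ ss) ⟧ (extend names s))
T-Theta-extend names inj s ss =
  T-tensorList-head (conjOf names s) (map (conjOf names) ss) (extend names s)
    (T-conjOf names s (extend names s) (extend-names names inj s))

lemma4p5 : (n : ℕ) (names : Fin n → ℕ) → Injective _≡_ _≡_ names →
    (X : List⁺ (Fin n → Bool)) → Projective FlatSubst (Theta names X)
lemma4p5 n names inj X@(s ∷ ss) =
  classical-projective (Theta names X) (classical-Theta names X)
    (extend names s) (T-Theta-extend names inj s ss)
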